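{- Let $L$ be a bounded lattice, $\Lambda$ a meet-dense set of elements of $L$, and $\neg$ an antitone unary operation on $L$. Let $P=\{(a,\neg a)\mid a\in L\}\cup\{(1,b)\mid b\in\Lambda\}$, define $\vartriangleleft$ on $P$ by $(a,b)\vartriangleleft(c,d)$ iff $c\not\le b$, and let $F=c_\vartriangleleft(\{(\neg1,\neg\neg1)\})$. Then there is a complete embedding of $(L,\neg)$ into $(\mathfrak{L}(P,\vartriangleleft),\neg_{\vartriangleleft,F})$, which is an isomorphism if $L$ is complete.
   Context: A set is meet-dense in $L$ if every element of $L$ is the meet of some subset of it. Antitone: $a\le b$ implies $\neg b\le\neg a$. For a nonempty set $X$ with binary relation $\vartriangleleft$ (write $y\vartriangleright x$ for $x\vartriangleleft y$): $c_\vartriangleleft(A)=\{x\mid\forall x'\vartriangleleft x\ \exists x''\vartriangleright x':x''\in A\}$; $\mathfrak{L}(X,\vartriangleleft)$ is the complete lattice of sets $A$ with $c_\vartriangleleft(A)=A$, ordered by inclusion (meets are intersections, joins are $c_\vartriangleleft$ of unions). For a $c_\vartriangleleft$-fixpoint $F$, $\neg_{\vartriangleleft,F}A=\{x\in X\mid\forall x'\vartriangleleft x\,(x'\in A\Rightarrow\exists x''\vartriangleright x':x''\in F)\}$. A complete embedding of $(L,\neg)$ into $(L',\neg')$ is an injective map preserving all existing meets and joins and commuting with negation. -}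

module Defs where

open import Level using (Level; _⊔_) renaming (suc to lsuc)
open import Data.Product using (Σ; ∃; _×_; _,_; proj₁; proj₂)
open import Data.Sum using (_⊎_)
open import Relation.Nullary using (¬_)
open import Relation.Unary using (Pred; _⊆_; _∈_)
open import Relation.Binary using (Rel)
open import Relation.Binary.PropositionalEquality using (_≡_)
open import Relation.Binary.Lattice.Bundles using (BoundedLattice)

module _ {a r s : Level} {A : Set a} (_≤_ : Rel A r) where

  IsLowerBound : Pred A s → A → Set (a ⊔ r ⊔ s)
  IsLowerBound S m = ∀ x → S x → m ≤ x

  IsUpperBound : Pred A s → A → Set (a ⊔ r ⊔ s)
  IsUpperBound S m = ∀ x → S x → x ≤ m

  IsMeet : Pred A s → A → Set (a ⊔ r ⊔ s)
  IsMeet S m = IsLowerBound S m × (∀ m' → IsLowerBound S m' → m' ≤ m)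

  IsJoin : Pred A s → A → Set (a ⊔ r ⊔ s)
  IsJoin S m = IsUpperBound S m × (∀ m' → IsUpperBound S m' → m ≤ m')

module _ {ℓ : Level} (L : BoundedLattice ℓ ℓ ℓ) where
  open BoundedLattice L

  MeetDense : Pred Carrier ℓ → Set (lsuc ℓ)
  MeetDense Λ = ∀ a → Σ (Pred Carrier ℓ) λ S → (S ⊆ Λ) × IsMeet _≤_ S a

  Antitone : (Carrier → Carrier) → Set ℓ
  Antitone neg = ∀ a b → a ≤ b → neg b ≤ neg a

  IsComplete : Set (lsuc ℓ)
  IsComplete = ∀ (S : Pred Carrier ℓ) → (∃ λ m → IsMeet _≤_ S m) × (∃ λ j → IsJoin _≤_ S j)

module Closure {ℓ : Level} (X : Set ℓ) (_◁_ : Rel X ℓ) where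

  c◁ : Pred X ℓ → Pred X ℓ
  c◁ A x = ∀ x' → x' ◁ x → ∃ λ x'' → (x' ◁ x'') × A x''

  _≐_ : Rel (Pred X ℓ) ℓ
  A ≐ B = (A ⊆ B) × (B ⊆ A)

  IsFixpoint : Pred X ℓ → Set ℓ
  IsFixpoint A = c◁ A ≐ A

  𝔏 : Set (lsuc ℓ)
  𝔏 = Σ (Pred X ℓ) IsFixpoint

  _⊑_ : Rel 𝔏 ℓ
  A ⊑ B = proj₁ A ⊆ proj₁ B

  _≐𝔏_ : Rel 𝔏 ℓ
  A ≐𝔏 B = proj₁ A ≐ proj₁ B

  neg◁ : Pred X ℓ → Pred X ℓ → Pred X ℓ
  neg◁ F A x = ∀ x' → x' ◁ x → A x' → ∃ λ x'' → (x' ◁ x'') × F x''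

module Construction {ℓ : Level} (L : BoundedLattice ℓ ℓ ℓ)
                    (Λ : Pred (BoundedLattice.Carrier L) ℓ)
                    (neg : BoundedLattice.Carrier L → BoundedLattice.Carrier L) where
  open BoundedLattice L

  InP : Carrier × Carrier → Set ℓ
  InP (x , y) = (∃ λ a → (x ≡ a) × (y ≡ neg a)) ⊎ ((x ≡ ⊤) × Λ y)

  P : Set ℓ
  P = Σ (Carrier × Carrier) InP

  _◁_ : Rel P ℓ
  ((a , b) , _) ◁ ((c , d) , _) = ¬ (c ≤ b)

  open Closure P _◁_ public

  F : Pred P ℓ
  F = c◁ (λ p → proj₁ p ≡ (neg ⊤ , neg (neg ⊤)))

  Image : (Carrier → 𝔏) → Pred Carrier ℓ → Pred 𝔏 ℓ
  Image f S B = ∃ λ s → S s × (B ≐𝔏 f s)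

  record IsCompleteEmbedding (f : Carrier → 𝔏) : Set (lsuc ℓ) where
    field
      well-defined : ∀ {a b} → a ≈ b → f a ≐𝔏 f b
      injective    : ∀ {a b} → f a ≐𝔏 f b → a ≈ b
      pres-meets   : ∀ (S : Pred Carrier ℓ) m → IsMeet _≤_ S m → IsMeet _⊑_ (Image f S) (f m)
      pres-joins   : ∀ (S : Pred Carrier ℓ) j → IsJoin _≤_ S j → IsJoin _⊑_ (Image f S) (f j)
      pres-neg     : ∀ a → proj₁ (f (neg a)) ≐ neg◁ F (proj₁ (f a))

  Surjective : (Carrier → 𝔏) → Set (lsuc ℓ)
  Surjective f = ∀ (B : 𝔏) → ∃ λ a → f a ≐𝔏 B

{-# OPTIONS --safe #-}
module Submission where

-- Send a ∈ L to its principal downset ↓ a = {p ∈ P | fst p ≤ a}. Meet-density makes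
-- ↓ a closed: if fst x ≰ a, some b ∈ Λ above a has fst x ≰ b, and the point (1, b)
-- lies ◁ x but ◁ nothing in ↓ a. A point lies in c◁ A as soon as its first coordinate
-- is below every upper bound of the first coordinates of A; this gives preservation of
-- joins, and shows that every closed set is ↓ of the join of its first coordinates,
-- whence surjectivity for complete L. For negation, (¬1, ¬¬1) ∈ F witnesses
-- ↓ ¬a ⊆ ¬(↓ a), and the point (a, ¬a) ∈ ↓ a gives the converse inclusion.

open import Defs
open import Level using (Level; lift; lower) renaming (suc to lsuc)
open import Function using (id)
open import Data.Product using (Σ; ∃; _×_; _,_; proj₁; proj₂)
open import Data.Sum using (inj₁; inj₂)
open import Relation.Nullary using (¬_)
open import Relation.Nullary.Decidable using (map′)
open import Relation.Unary using (Pred; _⊆_)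
open import Relation.Binary using (Rel)
open import Relation.Binary.PropositionalEquality using (_≡_; refl)
open import Relation.Binary.Lattice.Bundles using (BoundedLattice)
open import Axiom.ExcludedMiddle using (ExcludedMiddle)
open import Axiom.DoubleNegationElimination using (DoubleNegationElimination; em⇒dne)

em-lower : {ℓ : Level} → ExcludedMiddle (lsuc ℓ) → ExcludedMiddle ℓ
em-lower em = map′ lower lift em

module _ {ℓ : Level} {X : Set ℓ} (_◁_ : Rel X ℓ) where
  open Closure X _◁_

  ⊆-c◁ : {A : Pred X ℓ} → A ⊆ c◁ A
  ⊆-c◁ {x = x} Ax x' x'◁x = x , x'◁x , Ax

module Classical {ℓ : Level} (dne : DoubleNegationElimination ℓ) where

  ¬∀⇒∃¬ : {A : Set ℓ} {S R : Pred A ℓ} → ¬ (∀ x → S x → R x) → ∃ λ x → S x × ¬ R x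
  ¬∀⇒∃¬ ¬∀ = dne λ ¬∃ → ¬∀ λ x Sx → dne λ ¬Rx → ¬∃ (x , Sx , ¬Rx)

module Representation {ℓ : Level} (dne : DoubleNegationElimination ℓ)
    (L : BoundedLattice ℓ ℓ ℓ) (Λ : Pred (BoundedLattice.Carrier L) ℓ)
    (neg : BoundedLattice.Carrier L → BoundedLattice.Carrier L) where
  open BoundedLattice L renaming (refl to ≤-refl)
  open Construction L Λ neg
  open Classical dne

  fst snd : P → Carrier
  fst p = proj₁ (proj₁ p)
  snd p = proj₂ (proj₁ p)

  pt : Carrier → P
  pt a = (a , neg a) , inj₁ (a , refl , refl)

  -- fst p ≤ a does not determine p, so membership proofs in ↓ a often need {p} spelled out.
  ↓_ : Carrier → Pred P ℓ
  (↓ a) p = fst p ≤ a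

  ↓-mono : ∀ {a b} → a ≤ b → ↓ a ⊆ ↓ b
  ↓-mono a≤b p≤a = trans p≤a a≤b

  ↓-cong : ∀ {a b} → a ≈ b → (↓ a) ≐ (↓ b)
  ↓-cong a≈b = (λ {p} → ↓-mono (reflexive a≈b) {p}) , (λ {p} → ↓-mono (reflexive (Eq.sym a≈b)) {p})

  ↓-injective : ∀ {a b} → (↓ a) ≐ (↓ b) → a ≈ b
  ↓-injective (↓a⊆↓b , ↓b⊆↓a) = antisym (↓a⊆↓b {pt _} ≤-refl) (↓b⊆↓a {pt _} ≤-refl)

  c◁↓⊆↓ : MeetDense L Λ → ∀ a → c◁ (↓ a) ⊆ ↓ a
  c◁↓⊆↓ md a {x} x∈c◁↓a = dne λ x≰a →
    let (S , S⊆Λ , lb , glb) = md a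
        (b , Sb , x≰b) = ¬∀⇒∃¬ λ x≤S → x≰a (glb (fst x) x≤S)
        (x'' , x''≰b , x''≤a) = x∈c◁↓a ((⊤ , b) , inj₂ (refl , S⊆Λ Sb)) x≰b
    in x''≰b (trans x''≤a (lb b Sb))

  ↓-isFixpoint : MeetDense L Λ → ∀ a → IsFixpoint (↓ a)
  ↓-isFixpoint md a = (λ {x} → c◁↓⊆↓ md a {x}) , (λ {x} → ⊆-c◁ _◁_ {↓ a} {x})

  Fsts : Pred P ℓ → Pred Carrier ℓ
  Fsts A c = ∃ λ x → A x × fst x ≡ c

  ↓⊆c◁ : ∀ (A : Pred P ℓ) j → (∀ u → IsUpperBound _≤_ (Fsts A) u → j ≤ u) → ↓ j ⊆ c◁ A
  ↓⊆c◁ A j j≤ubs {p} p≤j x' p≰x' =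
    let (x , Ax , x≰x') = ¬∀⇒∃¬ λ A≤x' →
          p≰x' (trans p≤j (j≤ubs (snd x') λ { _ (x , Ax , refl) → A≤x' x Ax }))
    in x , x≰x' , Ax

  ↓-join-Fsts≐ : ∀ (B : 𝔏) a → IsJoin _≤_ (Fsts (proj₁ B)) a → (↓ a) ≐ proj₁ B
  ↓-join-Fsts≐ B a (ub , lub) = ↓a⊆B , λ {x} Bx → ub (fst x) (x , Bx , refl)
    where
    ↓a⊆B : ↓ a ⊆ proj₁ B
    ↓a⊆B {p} p≤a = proj₁ (proj₂ B) (↓⊆c◁ (proj₁ B) a lub {p} p≤a)

  neg-≤-snd : Antitone L neg → ∀ p a → fst p ≤ a → neg ⊤ ≤ snd p → neg a ≤ snd p
  neg-≤-snd anti ((_ , _) , inj₁ (e , refl , refl)) a e≤a _        = anti e a e≤a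
  neg-≤-snd anti ((_ , d) , inj₂ (refl , _))        a ⊤≤a ¬⊤≤d = trans (anti ⊤ a ⊤≤a) ¬⊤≤d

  pt¬⊤∈F : F (pt (neg ⊤))
  pt¬⊤∈F _ x◁pt = pt (neg ⊤) , x◁pt , refl

  pt◁⇒∉F : Antitone L neg → ∀ a {x} → pt a ◁ x → ¬ F x
  pt◁⇒∉F anti a pt◁x x∈F with x∈F (pt a) pt◁x
  ... | _ , pt◁z , refl = pt◁z (anti a ⊤ (maximum a))

  ↓-neg : Antitone L neg → ∀ a → (↓ neg a) ≐ neg◁ F (↓ a)
  ↓-neg anti a = (λ {x} → ↓¬⊆¬↓ {x}) , (λ {x} → ¬↓⊆↓¬ {x})
    where
    ↓¬⊆¬↓ : ↓ neg a ⊆ neg◁ F (↓ a)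
    ↓¬⊆¬↓ x≤¬a x' x≰x' x'≤a =
      pt (neg ⊤) , (λ ¬⊤≤x' → x≰x' (trans x≤¬a (neg-≤-snd anti x' a x'≤a ¬⊤≤x'))) , pt¬⊤∈F
    ¬↓⊆↓¬ : neg◁ F (↓ a) ⊆ ↓ neg a
    ¬↓⊆↓¬ x∈¬↓a = dne λ x≰¬a →
      let (x'' , pt◁x'' , x''∈F) = x∈¬↓a (pt a) x≰¬a ≤-refl
      in pt◁⇒∉F anti a {x''} pt◁x'' x''∈F

  ↓𝔏 : MeetDense L Λ → Carrier → 𝔏
  ↓𝔏 md a = ↓ a , ↓-isFixpoint md a

  module _ (md : MeetDense L Λ) where

    ∈-Image : ∀ {S s} → S s → Image (↓𝔏 md) S (↓𝔏 md s)
    ∈-Image {s = s} Ss = s , Ss , id , id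

    ↓𝔏-pres-meets : ∀ S m → IsMeet _≤_ S m → IsMeet _⊑_ (Image (↓𝔏 md) S) (↓𝔏 md m)
    ↓𝔏-pres-meets S m (lb , glb) =
      (λ { B (s , Ss , B≐↓s) {p} p≤m → proj₂ B≐↓s {p} (↓-mono (lb s Ss) {p} p≤m) })
      , λ B B≤S {p} p∈B → glb _ λ s Ss → B≤S (↓𝔏 md s) (∈-Image Ss) p∈B

    ↓𝔏-pres-joins : ∀ S j → IsJoin _≤_ S j → IsJoin _⊑_ (Image (↓𝔏 md) S) (↓𝔏 md j)
    ↓𝔏-pres-joins S j (ub , lub) =
      (λ { B (s , Ss , B≐↓s) {p} p∈B → ↓-mono (ub s Ss) {p} (proj₁ B≐↓s p∈B) })
      , λ B S≤B {p} p≤j → proj₁ (proj₂ B) {p} (↓⊆c◁ (proj₁ B) j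
          (λ u B≤u → lub u λ s Ss → B≤u s (pt s , S≤B (↓𝔏 md s) (∈-Image Ss) {pt s} ≤-refl , refl))
          {p} p≤j)

    ↓𝔏-isCompleteEmbedding : Antitone L neg → IsCompleteEmbedding (↓𝔏 md)
    ↓𝔏-isCompleteEmbedding anti = record
      { well-defined = λ {a} {b} → ↓-cong {a} {b}
      ; injective    = λ {a} {b} → ↓-injective {a} {b}
      ; pres-meets   = ↓𝔏-pres-meets
      ; pres-joins   = ↓𝔏-pres-joins
      ; pres-neg     = ↓-neg anti
      }

    ↓𝔏-surjective : IsComplete L → Surjective (↓𝔏 md)
    ↓𝔏-surjective complete B =
      let (a , a-join) = proj₂ (complete (Fsts (proj₁ B))) in a , ↓-join-Fsts≐ B a a-join

theorem4p29 : {ℓ : Level} → ExcludedMiddle (lsuc ℓ) →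
    (L : BoundedLattice ℓ ℓ ℓ) (Λ : Pred (BoundedLattice.Carrier L) ℓ)
    (neg : BoundedLattice.Carrier L → BoundedLattice.Carrier L) →
    MeetDense L Λ → Antitone L neg →
    Σ (BoundedLattice.Carrier L → Construction.𝔏 L Λ neg) λ f →
      Construction.IsCompleteEmbedding L Λ neg f × (IsComplete L → Construction.Surjective L Λ neg f)
theorem4p29 em L Λ neg md anti = ↓𝔏 md , ↓𝔏-isCompleteEmbedding md anti , ↓𝔏-surjective md
  where open Representation (em⇒dne (em-lower em)) L Λ neg
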